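{- Let $\mathcal{A}$ be a complete set of axioms and let $\mathcal{B}=\{\tilde{\sf c}_i\sim A_i\}_{i\in I}\subseteq\mathcal{A}$ be such that $\{\tilde{\sf c}_i\}_{i\in I}$ is an equivalence class for $\mathcal{A}$, each $A_i$ is of one of the forms $\tilde{\sf c}_i$, $\tilde{\sf c}\to\tilde{\sf c}'$, $\tilde{\sf c}\cap\tilde{\sf c}'$, and every constant occurring in $\mathcal{B}$ lies either in $\{\tilde{\sf c}_i\}_{i\in I}$ or in a set $\{\tilde{\sf c}_j\}_{j\in J}$ with $I\cap J=\emptyset$, for each of which a saturated set $\overline{X}_j\in\mathsf{SAT}$ is given. Put $\mathcal{B}^{\mathcal{A}}=\mathcal{B}\cup\{\tilde{\sf c}_j\sim\tilde{\sf c}_j\}_{j\in J}$, and let $\{\tilde{\sf c}_h^{\,p_h}\}_{h\in I\cup J}$ be a decoration agreeing with $\mathcal{B}^{\mathcal{A}}$ with $p_j=\pm$ for all $j\in J$. Define $\Phi_{\mathcal{B}^{\mathcal{A}}}:\prod_{h\in I\cup J}\mathcal{X}_h\to\prod_{h\in I\cup J}\mathcal{X}_h$ by $\Phi_{\mathcal{B}^{\mathcal{A}}}(\langle X_h\rangle_{h\in I\cup J})=\langle[A_h]\rangle_{h\in I\cup J}$ (with $A_j=\tilde{\sf c}_j$ for $j\in J$), where $[\cdot]$ interprets each occurrence of a constant $\tilde{\sf c}_j$ with $j\in J$ as $\overline{X}_j$, each occurrence of $\tilde{\sf c}_i$ with $i\in I$ as the variable $X_i$, $\to$ as $\Rightarrow$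 and $\cap$ as $\cap$. Then $\Phi_{\mathcal{B}^{\mathcal{A}}}$ is monotone with respect to the product order.
   Context: $\Lambda$ is the set of $\lambda$-terms, $\mathcal{S}$ the solvable terms, $\mathcal{B}_0=\{M\mid M\to^*_\beta xM_1\cdots M_m\}$; $X\subseteq\mathcal{S}$ is saturated if closed under $\beta$-conversion and containing all $xM_1\cdots M_m$. $\mathsf{SAT}$ is the complete lattice of saturated sets $X$ with $\mathcal{B}_0\subseteq X\subseteq\mathcal{S}$ ordered by $\subseteq$; $\mathsf{SAT}^{op}$ is the same set ordered by $\supseteq$. $X\Rightarrow Y=\{M\mid\forall N\in X.\ MN\in Y\}$. In the product, $\mathcal{X}_h=\mathsf{SAT}$ if $p_h\in\{+,\pm\}$ and $\mathcal{X}_h=\mathsf{SAT}^{op}$ if $p_h=-$, ordered componentwise. A set of axioms $\mathcal{A}=\{{\sf c}_i\sim A_i\}_{i\in I}$ consists of formal equations between pairwise distinct type constants ${\sf c}_i$ and intersection types $A_i$; $C(\mathcal{A})=\{{\sf c}_i\}_{i\in I}$. $\mathcal{A}$ is complete if every constant occurring in a right-hand side is in $C(\mathcal{A})$. For complete $\mathcal{A}$ and ${\sf c}\in C(\mathcal{A})$, $\mathrm{cl}_{\mathcal{A}}({\sf c})=C(\mathcal{A}')$ for the smallest complete $\mathcal{A}'\subseteq\mathcal{A}$ with ${\sf c}\in C(\mathcal{A}')$; the equivalence class of ${\sf c}$ for $\mathcal{A}$ is $\{{\sf c}'\in C(\mathcal{A})\mid\mathrm{cl}_{\mathcal{A}}({\sf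 c})=\mathrm{cl}_{\mathcal{A}}({\sf c}')\}$. Polarities $p\in\{+,-,\pm\}$; $\mathbf{Pos},\mathbf{Neg}$ are the least predicates on decorated types with $\mathbf{Pos}({\sf c}^+)$, $\mathbf{Pos}({\sf c}^\pm)$, $\mathbf{Neg}({\sf c}^-)$, $\mathbf{Neg}({\sf c}^\pm)$, $\mathbf{Neg}(A)\wedge\mathbf{Pos}(B)\Rightarrow\mathbf{Pos}(A\to B)$, $\mathbf{Pos}(A)\wedge\mathbf{Neg}(B)\Rightarrow\mathbf{Neg}(A\to B)$, $\mathbf{Pos}(A)\wedge\mathbf{Pos}(B)\Rightarrow\mathbf{Pos}(A\cap B)$, $\mathbf{Neg}(A)\wedge\mathbf{Neg}(B)\Rightarrow\mathbf{Neg}(A\cap B)$. A decoration agrees with a set of axioms if $p_i=+$ implies $\mathbf{Pos}(A_i)$, $p_i=-$ implies $\mathbf{Neg}(A_i)$, and $p_i=\pm$ implies $A_i={\sf c}_i$. -}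

module Defs where

open import Data.Nat using (ℕ; zero; suc; _<_)
open import Data.List using (List; foldl)
open import Data.Product using (Σ; ∃; _×_; _,_)
open import Data.Sum using (_⊎_)
import Data.Sum
open import Relation.Nullary using (¬_)
open import Relation.Binary.PropositionalEquality using (_≡_)
open import Relation.Binary.Construct.Closure.ReflexiveTransitive using (Star)
open import Relation.Binary.Construct.Closure.Equivalence using (EqClosure)

-- λ-terms, de Bruijn indices (free variables = dangling indices)

data Λ : Set where
  var : ℕ → Λ
  _·_ : Λ → Λ → Λ
  ƛ   : Λ → Λ

infixl 7 _·_
infix 8 _[_]
infix 4 _→β_ _→β*_ _=β_

rename : (ℕ → ℕ) → Λ → Λ
rename ρ (var x) = var (ρ x)
rename ρ (M · N) = rename ρ M · rename ρ N
rename ρ (ƛ M)   = ƛ (rename (λ { zero → zero ; (suc n) → suc (ρ n) }) M)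

exts : (ℕ → Λ) → ℕ → Λ
exts σ zero    = var zero
exts σ (suc n) = rename suc (σ n)

sub : (ℕ → Λ) → Λ → Λ
sub σ (var x) = σ x
sub σ (M · N) = sub σ M · sub σ N
sub σ (ƛ M)   = ƛ (sub (exts σ) M)

_[_] : Λ → Λ → Λ
M [ N ] = sub (λ { zero → N ; (suc n) → var n }) M

data _→β_ : Λ → Λ → Set where
  β    : ∀ {M N} → (ƛ M) · N →β M [ N ]
  appL : ∀ {M M' N} → M →β M' → M · N →β M' · N
  appR : ∀ {M N N'} → N →β N' → M · N →β M · N'
  lam  : ∀ {M M'} → M →β M' → ƛ M →β ƛ M'

_→β*_ : Λ → Λ → Set
_→β*_ = Star _→β_

_=β_ : Λ → Λ → Set
_=β_ = EqClosure _→β_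

apps : Λ → List Λ → Λ
apps = foldl _·_

lams : ℕ → Λ → Λ
lams zero    M = M
lams (suc k) M = ƛ (lams k M)

data Scoped : ℕ → Λ → Set where
  var : ∀ {k x} → x < k → Scoped k (var x)
  app : ∀ {k M N} → Scoped k M → Scoped k N → Scoped k (M · N)
  lam : ∀ {k M} → Scoped (suc k) M → Scoped k (ƛ M)

𝐈 : Λ
𝐈 = ƛ (var zero)

Pred : Set₁
Pred = Λ → Set

_⊆_ : Pred → Pred → Set
X ⊆ Y = ∀ M → X M → Y M

-- solvable: some closure λx⃗.M (with x⃗ ⊇ FV(M)) applied to suitable
-- arguments is β-convertible to I
𝒮 : Pred
𝒮 M = Σ ℕ λ k → Σ (List Λ) λ Ns → Scoped k M × (apps (lams k M) Ns =β 𝐈)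

HeadVar : Pred
HeadVar M = Σ ℕ λ x → Σ (List Λ) λ Ms → M ≡ apps (var x) Ms

ℬ₀ : Pred
ℬ₀ M = Σ Λ λ N → (M →β* N) × HeadVar N

Saturated : Pred → Set
Saturated X = (X ⊆ 𝒮) × (∀ M N → M =β N → X M → X N) × (HeadVar ⊆ X)

SAT : Pred → Set
SAT X = Saturated X × (ℬ₀ ⊆ X) × (X ⊆ 𝒮)

_⇒_ : Pred → Pred → Pred
(X ⇒ Y) M = ∀ N → X N → Y (M · N)

_∩ˢ_ : Pred → Pred → Pred
(X ∩ˢ Y) M = X M × Y M

data Ty (Const : Set) : Set where
  con : Const → Ty Const
  _⟶_ : Ty Const → Ty Const → Ty Const
  _∩_ : Ty Const → Ty Const → Ty Const

module _ {Const : Set} where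

  data _occursIn_ (c : Const) : Ty Const → Set where
    here : c occursIn con c
    ⟶ˡ   : ∀ {A B} → c occursIn A → c occursIn (A ⟶ B)
    ⟶ʳ   : ∀ {A B} → c occursIn B → c occursIn (A ⟶ B)
    ∩ˡ   : ∀ {A B} → c occursIn A → c occursIn (A ∩ B)
    ∩ʳ   : ∀ {A B} → c occursIn B → c occursIn (A ∩ B)

  ⟦_⟧ : Ty Const → (Const → Pred) → Pred
  ⟦ con c ⟧ ρ = ρ c
  ⟦ A ⟶ B ⟧ ρ = ⟦ A ⟧ ρ ⇒ ⟦ B ⟧ ρ
  ⟦ A ∩ B ⟧ ρ = ⟦ A ⟧ ρ ∩ˢ ⟦ B ⟧ ρ

record AxiomSet (Const : Set) : Set₁ where
  field
    Idx      : Set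
    cst      : Idx → Const
    rhs      : Idx → Ty Const
    distinct : ∀ i j → cst i ≡ cst j → i ≡ j

module _ {Const : Set} (𝒜 : AxiomSet Const) where
  open AxiomSet 𝒜

  C : Const → Set
  C c = Σ Idx λ i → cst i ≡ c

  -- sub-axiom-sets of 𝒜 are given by predicates on the indices
  C[_] : (Idx → Set) → Const → Set
  C[ P ] c = Σ Idx λ i → P i × cst i ≡ c

  CompleteSub : (Idx → Set) → Set
  CompleteSub P = ∀ i → P i → ∀ c → c occursIn rhs i → C[ P ] c

  Complete : Set
  Complete = ∀ i → ∀ c → c occursIn rhs i → C c

  -- cl_𝒜(c) = C(𝒜') for the smallest complete 𝒜' ⊆ 𝒜 with c ∈ C(𝒜'),
  -- i.e. the constants of the intersection of all such 𝒜'
  cl : Const → Const → Set₁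
  cl c c' = ∀ P → CompleteSub P → C[ P ] c → C[ P ] c'

  SameCl : Const → Const → Set₁
  SameCl c c' = (∀ d → cl c d → cl c' d) × (∀ d → cl c' d → cl c d)

  IsEquivClass : (Const → Set) → Set₁
  IsEquivClass E = Σ Const λ c₀ → C c₀ ×
    ((∀ c → E c → C c × SameCl c₀ c) × (∀ c → C c → SameCl c₀ c → E c))

data Pol : Set where
  ⊕ ⊖ ± : Pol

module _ {Const : Set} (pol : Const → Pol) where

  data Pos : Ty Const → Set
  data Neg : Ty Const → Set

  data Pos where
    c⊕  : ∀ {c} → pol c ≡ ⊕ → Pos (con c)
    c±  : ∀ {c} → pol c ≡ ± → Pos (con c)
    arr : ∀ {A B} → Neg A → Pos B → Pos (A ⟶ B)
    int : ∀ {A B} → Pos A → Pos B → Pos (A ∩ B)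

  data Neg where
    c⊖  : ∀ {c} → pol c ≡ ⊖ → Neg (con c)
    c±  : ∀ {c} → pol c ≡ ± → Neg (con c)
    arr : ∀ {A B} → Pos A → Neg B → Neg (A ⟶ B)
    int : ∀ {A B} → Neg A → Neg B → Neg (A ∩ B)

  Agrees : Const → Ty Const → Set
  Agrees c A = (pol c ≡ ⊕ → Pos A) × (pol c ≡ ⊖ → Neg A) × (pol c ≡ ± → A ≡ con c)

-- order of the component 𝒳_h: SAT for ⊕ and ±, SAT^op for ⊖
Le : Pol → Pred → Pred → Set
Le ⊕ X Y = X ⊆ Y
Le ± X Y = X ⊆ Y
Le ⊖ X Y = Y ⊆ X

SimpleForm : {Const : Set} → Const → Ty Const → Set
SimpleForm {Const} cᵢ A =
  (A ≡ con cᵢ) ⊎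
  (Σ Const λ c → Σ Const λ c' → A ≡ (con c ⟶ con c')) ⊎
  (Σ Const λ c → Σ Const λ c' → A ≡ (con c ∩ con c'))

-- the system 𝓑^𝒜 = 𝓑 ∪ {c̃ⱼ ∼ c̃ⱼ}_{j∈J}, indexed by H = I ⊎ J,
-- where 𝓑 ⊆ 𝒜 is given by the predicate inB on the indices of 𝒜

module _ {Const : Set} (𝒜 : AxiomSet Const) (inB : AxiomSet.Idx 𝒜 → Set)
         (J : Set) (cJ : J → Const) where
  open AxiomSet 𝒜

  I : Set
  I = Σ Idx inB

  H : Set
  H = I ⊎ J

  cstH : H → Const
  cstH (Data.Sum.inj₁ (i , _)) = cst i
  cstH (Data.Sum.inj₂ j)       = cJ j

  rhsH : H → Ty Const
  rhsH (Data.Sum.inj₁ (i , _)) = rhs i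
  rhsH (Data.Sum.inj₂ j)       = con (cJ j)

  -- ρ interprets c̃ᵢ (i ∈ I) as the variable Xᵢ and c̃ⱼ (j ∈ J) as X̄ⱼ
  Represents : (J → Pred) → (H → Pred) → (Const → Pred) → Set₁
  Represents X̄ X ρ =
    (∀ (i : I) → ρ (cstH (Data.Sum.inj₁ i)) ≡ X (Data.Sum.inj₁ i)) ×
    (∀ j → ρ (cJ j) ≡ X̄ j)

  ProdLe : (Const → Pol) → (H → Pred) → (H → Pred) → Set
  ProdLe pol X Y = ∀ h → Le (pol (cstH h)) (X h) (Y h)

  -- Φ_{𝓑^𝒜}(X) = ⟨ [A_h] ⟩_h computed with a representing valuation ρ
  Φ : (Const → Pred) → H → Pred
  Φ ρ h = ⟦ rhsH h ⟧ ρ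

-- Positive types are monotone and negative types antitone in the interpretation of their
-- constants, provided constants of polarity ± are held fixed. Each component of Φ is the
-- interpretation of a Pos or Neg type (or of a ± constant alone), so it suffices to see that
-- every ± constant occurring in 𝓑 is fixed. For c̃ⱼ (j ∈ J) this holds as both valuations send
-- it to X̄ⱼ. A ± constant c̃ᵢ of the class has the axiom c̃ᵢ ∼ c̃ᵢ, which is a complete axiom set
-- by itself, so its class is {c̃ᵢ}; hence it occurs only in its own axiom, where Φ's component
-- is Xᵢ itself.
module Submission where

open import Defs
open import Data.Product using (Σ; _×_; _,_; proj₁; proj₂; swap)
open import Data.Sum using (_⊎_; inj₁; inj₂)
open import Function using (_∘_)
open import Relation.Nullary using (¬_)
open import Relation.Binary.PropositionalEquality
  using (_≡_; _≢_; refl; sym; trans; subst; subst₂)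

⊆-reflexive : ∀ {X Y} → X ≡ Y → X ⊆ Y
⊆-reflexive refl M x = x

⇒-mono : ∀ {X X' Y Y'} → X' ⊆ X → Y ⊆ Y' → (X ⇒ Y) ⊆ (X' ⇒ Y')
⇒-mono X'⊆X Y⊆Y' M f N x = Y⊆Y' (M · N) (f N (X'⊆X N x))

∩ˢ-mono : ∀ {X X' Y Y'} → X ⊆ X' → Y ⊆ Y' → (X ∩ˢ Y) ⊆ (X' ∩ˢ Y')
∩ˢ-mono X⊆X' Y⊆Y' M (x , y) = X⊆X' M x , Y⊆Y' M y

-- Unlike Le, this compares a ± component by equality: Pos and Neg both admit ± constants.
Le± : Pol → Pred → Pred → Set
Le± ⊕ X Y = X ⊆ Y
Le± ⊖ X Y = Y ⊆ X
Le± ± X Y = X ⊆ Y × Y ⊆ X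

≡⇒Le± : ∀ {p X Y} → X ≡ Y → Le± p X Y
≡⇒Le± {⊕} refl = ⊆-reflexive refl
≡⇒Le± {⊖} refl = ⊆-reflexive refl
≡⇒Le± {±} refl = ⊆-reflexive refl , ⊆-reflexive refl

Le⇒Le± : ∀ {p X Y} → p ≢ ± → Le p X Y → Le± p X Y
Le⇒Le± {⊕} _ X≤Y = X≤Y
Le⇒Le± {⊖} _ X≤Y = X≤Y
Le⇒Le± {±} p≢± _ with () ← p≢± refl

module _ {Const : Set} (pol : Const → Pol) {ρ σ : Const → Pred} where

  ValLe± : Ty Const → Set
  ValLe± A = ∀ c → c occursIn A → Le± (pol c) (ρ c) (σ c)

  Pos⇒⟦⟧-mono : ∀ {A} → ValLe± A → Pos pol A → ⟦ A ⟧ ρ ⊆ ⟦ A ⟧ σ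
  Neg⇒⟦⟧-antimono : ∀ {A} → ValLe± A → Neg pol A → ⟦ A ⟧ σ ⊆ ⟦ A ⟧ ρ

  Pos⇒⟦⟧-mono ρ≤σ (c⊕ e) = subst (λ p → Le± p _ _) e (ρ≤σ _ here)
  Pos⇒⟦⟧-mono ρ≤σ (c± e) = proj₁ (subst (λ p → Le± p _ _) e (ρ≤σ _ here))
  Pos⇒⟦⟧-mono ρ≤σ (arr n p) =
    ⇒-mono (Neg⇒⟦⟧-antimono (λ c → ρ≤σ c ∘ ⟶ˡ) n) (Pos⇒⟦⟧-mono (λ c → ρ≤σ c ∘ ⟶ʳ) p)
  Pos⇒⟦⟧-mono ρ≤σ (int p q) =
    ∩ˢ-mono (Pos⇒⟦⟧-mono (λ c → ρ≤σ c ∘ ∩ˡ) p) (Pos⇒⟦⟧-mono (λ c → ρ≤σ c ∘ ∩ʳ) q)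

  Neg⇒⟦⟧-antimono ρ≤σ (c⊖ e) = subst (λ p → Le± p _ _) e (ρ≤σ _ here)
  Neg⇒⟦⟧-antimono ρ≤σ (c± e) = proj₂ (subst (λ p → Le± p _ _) e (ρ≤σ _ here))
  Neg⇒⟦⟧-antimono ρ≤σ (arr p n) =
    ⇒-mono (Pos⇒⟦⟧-mono (λ c → ρ≤σ c ∘ ⟶ˡ) p) (Neg⇒⟦⟧-antimono (λ c → ρ≤σ c ∘ ⟶ʳ) n)
  Neg⇒⟦⟧-antimono ρ≤σ (int p q) =
    ∩ˢ-mono (Neg⇒⟦⟧-antimono (λ c → ρ≤σ c ∘ ∩ˡ) p) (Neg⇒⟦⟧-antimono (λ c → ρ≤σ c ∘ ∩ʳ) q)

  Agrees⇒Le : ∀ {c A} → Agrees pol c A → (pol c ≢ ± → ValLe± A) → Le (pol c) (ρ c) (σ c) →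
              Le (pol c) (⟦ A ⟧ ρ) (⟦ A ⟧ σ)
  Agrees⇒Le {c} (pos , neg , fixed) ρ≤σ ρc≤σc with pol c
  ... | ⊕ = Pos⇒⟦⟧-mono (ρ≤σ λ ()) (pos refl)
  ... | ⊖ = Neg⇒⟦⟧-antimono (ρ≤σ λ ()) (neg refl)
  ... | ± = subst (λ A → ⟦ A ⟧ ρ ⊆ ⟦ A ⟧ σ) (sym (fixed refl)) ρc≤σc

module _ {Const : Set} (𝒜 : AxiomSet Const) where
  open AxiomSet 𝒜

  SameCl-sym : ∀ {c c'} → SameCl 𝒜 c c' → SameCl 𝒜 c' c
  SameCl-sym = swap

  SameCl-trans : ∀ {c c' c''} → SameCl 𝒜 c c' → SameCl 𝒜 c' c'' → SameCl 𝒜 c c''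
  SameCl-trans (f , g) (f' , g') = (λ d → f' d ∘ f d) , (λ d → g d ∘ g' d)

  IsEquivClass⇒SameCl : ∀ {E c c'} → IsEquivClass 𝒜 E → E c → E c' → SameCl 𝒜 c c'
  IsEquivClass⇒SameCl (_ , _ , members , _) e e' =
    SameCl-trans (SameCl-sym (proj₂ (members _ e))) (proj₂ (members _ e'))

  cl-refl : ∀ {c} → cl 𝒜 c c
  cl-refl P _ c∈P = c∈P

  occursIn-con : ∀ {c d : Const} → d occursIn con c → c ≡ d
  occursIn-con here = refl

  trivial-axiom-CompleteSub : ∀ i → rhs i ≡ con (cst i) → CompleteSub 𝒜 (_≡ i)
  trivial-axiom-CompleteSub i rhs≡ _ refl d d∈rhs =
    i , refl , occursIn-con (subst (d occursIn_) rhs≡ d∈rhs)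

  trivial-axiom⇒SameCl⇒≡ : ∀ i {c} → rhs i ≡ con (cst i) → SameCl 𝒜 (cst i) c → cst i ≡ c
  trivial-axiom⇒SameCl⇒≡ i rhs≡ same
    with proj₂ same _ cl-refl (_≡ i) (trivial-axiom-CompleteSub i rhs≡) (i , refl , refl)
  ... | _ , refl , cst≡c = cst≡c

proposition49 : {Const : Set} (𝒜 : AxiomSet Const) → Complete 𝒜 →
    (inB : AxiomSet.Idx 𝒜 → Set) →
    IsEquivClass 𝒜 (λ c → Σ (AxiomSet.Idx 𝒜) λ i → inB i × AxiomSet.cst 𝒜 i ≡ c) →
    (∀ i → inB i → SimpleForm (AxiomSet.cst 𝒜 i) (AxiomSet.rhs 𝒜 i)) →
    (J : Set) (cJ : J → Const) →
    (∀ j j' → cJ j ≡ cJ j' → j ≡ j') →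
    (∀ j i → inB i → ¬ (cJ j ≡ AxiomSet.cst 𝒜 i)) →
    (∀ i → inB i → ∀ c → c occursIn AxiomSet.rhs 𝒜 i →
       (Σ (AxiomSet.Idx 𝒜) λ i' → inB i' × AxiomSet.cst 𝒜 i' ≡ c) ⊎ (Σ J λ j → cJ j ≡ c)) →
    (X̄ : J → Pred) → (∀ j → SAT (X̄ j)) →
    (pol : Const → Pol) →
    (∀ h → Agrees pol (cstH 𝒜 inB J cJ h) (rhsH 𝒜 inB J cJ h)) →
    (∀ j → pol (cJ j) ≡ ±) →
    ∀ (X Y : H 𝒜 inB J cJ → Pred) →
    (∀ h → SAT (X h)) → (∀ h → SAT (Y h)) →
    ProdLe 𝒜 inB J cJ pol X Y →
    ∀ (ρ σ : Const → Pred) →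
    Represents 𝒜 inB J cJ X̄ X ρ → Represents 𝒜 inB J cJ X̄ Y σ →
    ProdLe 𝒜 inB J cJ pol (Φ 𝒜 inB J cJ ρ) (Φ 𝒜 inB J cJ σ)
proposition49 𝒜 _ inB class _ J cJ _ _ occ X̄ _ pol agrees pol-J X Y _ _ X≤Y ρ σ (ρ-I , ρ-J) (σ-I , σ-J)
  = Φ-mono
  where
  open AxiomSet 𝒜

  ρ≤σ-I : ∀ i → Le (pol (cst (proj₁ i))) (ρ (cst (proj₁ i))) (σ (cst (proj₁ i)))
  ρ≤σ-I i = subst₂ (Le _) (sym (ρ-I i)) (sym (σ-I i)) (X≤Y (inj₁ i))

  ρ≡σ-J : ∀ j → ρ (cJ j) ≡ σ (cJ j)
  ρ≡σ-J j = trans (ρ-J j) (sym (σ-J j))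

  ±-isolated : ∀ {i i'} → inB i → inB i' → pol (cst i') ≡ ± → cst i' ≡ cst i
  ±-isolated {i} {i'} b b' e = trivial-axiom⇒SameCl⇒≡ 𝒜 i' (proj₂ (proj₂ (agrees (inj₁ (i' , b')))) e)
    (IsEquivClass⇒SameCl 𝒜 class (i' , b' , refl) (i , b , refl))

  rhs-ValLe± : ∀ i → pol (cst (proj₁ i)) ≢ ± → ValLe± pol (rhs (proj₁ i))
  rhs-ValLe± (i , b) pol≢± d d∈rhs with occ i b d d∈rhs
  ... | inj₂ (j , refl) = ≡⇒Le± (ρ≡σ-J j)
  ... | inj₁ (i' , b' , refl) =
    Le⇒Le± (λ e → pol≢± (subst (λ c → pol c ≡ ±) (±-isolated b b' e) e)) (ρ≤σ-I (i' , b'))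

  Φ-mono : ProdLe 𝒜 inB J cJ pol (Φ 𝒜 inB J cJ ρ) (Φ 𝒜 inB J cJ σ)
  Φ-mono (inj₁ i) = Agrees⇒Le pol (agrees (inj₁ i)) (rhs-ValLe± i) (ρ≤σ-I i)
  Φ-mono (inj₂ j) = subst (λ p → Le p _ _) (sym (pol-J j)) (⊆-reflexive (ρ≡σ-J j))
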